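{- Let $F=(S,\{E_C\}_{C\subseteq N})\in\mathsf{Dev}(N)$ and $U\subseteq S$. Let $F\upharpoonright U=(U,\{E_C^U\}_{C\subseteq N})$ with $E_C^U=E_C\cap(U\times U)$. Then $F\upharpoonright U\in\mathsf{Dev}(N)$ if and only if $U$ is factor closed: for all $s,t\in U$ and all $C,D\subseteq N$, if $sE_{C\cup D}t$ then there exists $u\in U$ with $sE_Cu$ and $uE_Dt$.
   Context: $N$ finite set. $\mathsf{Dev}(N)$ is the class of frames $(S,\{E_C\}_{C\subseteq N})$ such that each $E_C$ is an equivalence relation on $S$, $E_\emptyset$ is the identity on $S$, $E_C\subseteq E_D$ whenever $C\subseteq D$, and $E_C\circ E_D=E_{C\cup D}$ for all $C,D$, where $s(E_C\circ E_D)t$ iff $\exists u\,(sE_Cu\wedge uE_Dt)$. -}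

module Defs where

open import Level using (Level; _⊔_)
open import Data.Nat using (ℕ)
open import Data.Bool using (Bool; T)
open import Data.Fin.Subset using (Subset; ⊥; _∪_; _⊆_)
open import Data.Product using (Σ; ∃; _×_; _,_; proj₁)
open import Relation.Binary.Core using (Rel)
open import Relation.Binary.Structures using (IsEquivalence)
open import Relation.Binary.PropositionalEquality using (_≡_)

-- The agent set N is Fin n; coalitions C ⊆ N are Subset n.
-- A frame on carrier S is a family of relations indexed by coalitions.
Frame : {a : Level} (n : ℕ) (S : Set a) (ℓ : Level) → Set (a ⊔ Level.suc ℓ)
Frame n S ℓ = Subset n → Rel S ℓ

_∘ᴿ_ : {a ℓ : Level} {S : Set a} → Rel S ℓ → Rel S ℓ → Rel S (a ⊔ ℓ)
(R ∘ᴿ Q) s t = ∃ λ u → R s u × Q u t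

record IsDev {a ℓ : Level} {n : ℕ} {S : Set a} (E : Frame n S ℓ) : Set (a ⊔ Level.suc ℓ) where
  field
    equiv    : ∀ C → IsEquivalence (E C)
    empty→≡  : ∀ {s t} → E ⊥ s t → s ≡ t
    ≡→empty  : ∀ {s t} → s ≡ t → E ⊥ s t
    mono     : ∀ {C D} → C ⊆ D → ∀ {s t} → E C s t → E D s t
    comp→∪   : ∀ C D {s t} → (E C ∘ᴿ E D) s t → E (C ∪ D) s t
    ∪→comp   : ∀ C D {s t} → E (C ∪ D) s t → (E C ∘ᴿ E D) s t

-- Subsets U ⊆ S are given by characteristic functions S → Bool,
-- so that the carrier Σ S (T ∘ U) has proof-irrelevant membership witnesses.
Carrier↾ : {a : Level} {S : Set a} → (S → Bool) → Set a
Carrier↾ {S = S} U = Σ S (λ s → T (U s))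

_↾_ : {a ℓ : Level} {n : ℕ} {S : Set a} → Frame n S ℓ → (U : S → Bool) → Frame n (Carrier↾ U) ℓ
(E ↾ U) C x y = E C (proj₁ x) (proj₁ y)

FactorClosed : {a ℓ : Level} {n : ℕ} {S : Set a} → Frame n S ℓ → (S → Bool) → Set (a ⊔ ℓ)
FactorClosed {n = n} {S = S} E U =
  ∀ (s t : S) → T (U s) → T (U t) → ∀ (C D : Subset n) →
  E (C ∪ D) s t → ∃ λ u → T (U u) × E C s u × E D u t

{-# OPTIONS --safe #-}
module Submission where

-- E^U_C is E_C pulled back along the inclusion U ↪ S, which is injective since
-- membership proofs T (U s) are irrelevant. Hence every Dev axiom except
-- E_{C∪D} ⊆ E_C ∘ E_D passes to F↾U unconditionally, and that one axiom for F↾U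
-- says exactly that U is factor closed.

open import Defs
open import Level using (Level)
open import Data.Nat using (ℕ)
open import Data.Bool using (Bool; T)
open import Data.Fin.Subset using (_∪_)
open import Data.Bool.Properties using (T-irrelevant)
open import Data.Product using (_,_; proj₁)
open import Data.Product.Properties using (Σ-≡,≡→≡)
open import Function.Bundles using (_⇔_; mk⇔)
open import Relation.Binary.PropositionalEquality using (_≡_; refl; cong)
import Relation.Binary.Construct.On as On

module _ {a : Level} {S : Set a} {U : S → Bool} where

  Carrier↾-≡ : {x y : Carrier↾ U} → proj₁ x ≡ proj₁ y → x ≡ y
  Carrier↾-≡ {s , p} {.s , q} refl = Σ-≡,≡→≡ (refl , T-irrelevant p q)

module _ {a ℓ : Level} {n : ℕ} {S : Set a} {E : Frame n S ℓ} {U : S → Bool} where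

  isDev↾⇒factorClosed : IsDev (E ↾ U) → FactorClosed E U
  isDev↾⇒factorClosed dev↾ s t s∈U t∈U C D sEt
    with (u , u∈U) , sEu , uEt ← IsDev.∪→comp dev↾ C D {s , s∈U} {t , t∈U} sEt
    = u , u∈U , sEu , uEt

  factorClosed⇒isDev↾ : IsDev E → FactorClosed E U → IsDev (E ↾ U)
  factorClosed⇒isDev↾ dev closed = record
    { equiv    = λ C → On.isEquivalence proj₁ (equiv C)
    ; empty→≡  = λ sEt → Carrier↾-≡ (empty→≡ sEt)
    ; ≡→empty  = λ s≡t → ≡→empty (cong proj₁ s≡t)
    ; mono     = λ C⊆D → mono C⊆D
    ; comp→∪   = λ C D ((u , _) , sEu , uEt) → comp→∪ C D (u , sEu , uEt)
    ; ∪→comp   = ∪→comp↾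
    }
    where
    open IsDev dev
    ∪→comp↾ : ∀ C D {x y} → (E ↾ U) (C ∪ D) x y → ((E ↾ U) C ∘ᴿ (E ↾ U) D) x y
    ∪→comp↾ C D {s , s∈U} {t , t∈U} sEt
      with u , u∈U , sEu , uEt ← closed s t s∈U t∈U C D sEt
      = (u , u∈U) , sEu , uEt

proposition6 : {a ℓ : Level} {n : ℕ} {S : Set a} (E : Frame n S ℓ) → IsDev E →
    (U : S → Bool) → IsDev (E ↾ U) ⇔ FactorClosed E U
proposition6 E dev U = mk⇔ isDev↾⇒factorClosed (factorClosed⇒isDev↾ dev)
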